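{- Let $\mathcal L_\mathcal P$ be a labeling of a pipe dream $\mathcal P$. Suppose $\mathcal Q$ can be reached from $\mathcal P$ by a sequence of simple ladder moves. Then $\mathcal Q$ inherits the same labeling from $\mathcal P$ regardless of the choice of sequence of simple ladder moves.
   Context: A pipe dream is a tiling of the grid $\mathbb Z_{>0}\times\mathbb Z_{>0}$ (rows and columns indexed in matrix notation, $(i,j)$ = row $i$ from the top, column $j$ from the left) by pluses and elbows; it is identified with the set of coordinates of its pluses. A simple ladder move $\mathcal P\mapsto\mathcal P'$ is the replacement of a $2\times 2$ configuration with elbows at $(i,j)$, $(i,j-1)$... more precisely: $\mathcal P'$ is obtained from $\mathcal P$ by adding a plus at some position $(i,j)\notin\mathcal P$ and removing the plus at $(i+1,j-1)\in\mathcal P$, where positions $(i,j-1)$ and $(i+1,j)$ are elbows (the local picture $\begin{array}{cc}\cdot&\cdot\\+&\cdot\end{array}\mapsto\begin{array}{cc}\cdot&+\\\cdot&\cdot\end{array}$ in consecutive rows $i,i+1$ and columns $j-1,j$). Fix an indexing set $I$. A labeling of a pipe dream $\mathcal P$ is an injective map $\mathcal L_\mathcal P:\mathcal P\to I$. If $\mathcal P\mapsto\mathcal P'$ is a simple ladder move, $\mathcal P'$ inherits the labeling $\mathcal L_{\mathcal P'}(i,j)=\mathcal L_\mathcal P(i,j)$ if $(i,j)\in\mathcal P$, and $\mathcal L_{\mathcal P'}(i,j)=\mathcal L_\mathcal P(i+1,j-1)$ otherwise. If there is a path of simple ladder moves from $\mathcal P$ to $\mathcal Q$, then $\mathcal Q$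 inherits a labeling from $\mathcal L_\mathcal P$ by applying this rule inductively along the path. -}

module Defs where

open import Data.Nat using (ℕ; suc)
import Data.Nat.Properties as ℕP
open import Data.Product using (_×_; _,_)
open import Data.Product.Properties using (≡-dec)
open import Data.Bool using (Bool; true; false; if_then_else_)
open import Relation.Binary.PropositionalEquality using (_≡_)
open import Relation.Binary.Definitions using (DecidableEquality)
open import Relation.Nullary.Decidable using (⌊_⌋)

-- Positions of the grid ℤ>0 × ℤ>0, shifted to be 0-indexed:
-- the pair (i , j) stands for row (i+1) from the top, column (j+1) from the left.
Pos : Set
Pos = ℕ × ℕ

_≟ₚ_ : DecidableEquality Pos
_≟ₚ_ = ≡-dec ℕP._≟_ ℕP._≟_

-- A pipe dream, identified with the set of its pluses
-- (p is a plus iff P p ≡ true, an elbow iff P p ≡ false).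
PipeDream : Set
PipeDream = Pos → Bool

-- A simple ladder move P ↦ P' : add a plus at (i , j) ∉ P (here j = suc k, so that
-- column j-1 exists), remove the plus at (i+1 , j-1) ∈ P, where (i , j-1) and
-- (i+1 , j) are elbows of P; every other position is unchanged.
data SimpleLadderMove (P P' : PipeDream) : Set where
  move : (i k : ℕ) →
         P (i , suc k) ≡ false →
         P (suc i , k) ≡ true →
         P (i , k) ≡ false →
         P (suc i , suc k) ≡ false →
         (∀ p → P' p ≡ (if ⌊ p ≟ₚ (i , suc k) ⌋ then true
                        else (if ⌊ p ≟ₚ (suc i , k) ⌋ then false else P p))) →
         SimpleLadderMove P P'

data LadderPath : PipeDream → PipeDream → Set where
  done : ∀ {P} → LadderPath P P
  step : ∀ {P P' Q} → SimpleLadderMove P P' → LadderPath P' Q → LadderPath P Q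

-- A labeling of P with values in I: a map on positions, injective on the pluses of P
-- (only its values on the pluses of P are meaningful).
IsLabeling : {I : Set} → PipeDream → (Pos → I) → Set
IsLabeling P L = ∀ p q → P p ≡ true → P q ≡ true → L p ≡ L q → p ≡ q

inheritStep : {I : Set} {P P' : PipeDream} → SimpleLadderMove P P' → (Pos → I) → Pos → I
inheritStep (move i k _ _ _ _ _) L p =
  if ⌊ p ≟ₚ (i , suc k) ⌋ then L (suc i , k) else L p

inherit : {I : Set} {P Q : PipeDream} → LadderPath P Q → (Pos → I) → Pos → I
inherit done L = L
inherit (step m π) L = inherit π (inheritStep m L)

module Submission where

-- A simple ladder move takes the plus at b = (i+1 , k) to
-- a = (i , k+1): both cells lie on the same antidiagonal (row + column
-- constant), and in the antidiagonal listed by increasing row they are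
-- consecutive, a immediately before b.  Hence, reading the labels of the
-- pluses of a pipe dream along any antidiagonal gives a word that a move,
-- together with the inherited labeling, leaves unchanged.  By induction every
-- path P ↦ ⋯ ↦ Q produces, on each antidiagonal of Q, the same label word as
-- L produces on that antidiagonal of P.  Two paths therefore give labelings of
-- Q with equal label words on every antidiagonal, so they agree on every plus
-- of Q.

open import Defs
open import Data.Bool using (true; false; if_then_else_)
open import Data.Nat using (ℕ; zero; suc; _+_)
open import Data.Nat.Properties using (+-identityʳ; +-suc)
open import Data.Product using (_,_; proj₁; proj₂)
open import Data.List using (List; []; _∷_; map)
open import Data.List.Properties using (∷-injective)
open import Data.List.Membership.Propositional using (_∈_)
open import Data.List.Relation.Unary.Any using (here; there)
open import Relation.Binary.PropositionalEquality
  using (_≡_; _≢_; refl; sym; trans; cong₂)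
open import Relation.Nullary using (yes; no)
open import Relation.Nullary.Decidable using (⌊_⌋; isYes≗does; dec-true; dec-false)

diagFrom : ℕ → ℕ → List Pos
diagFrom m zero    = (m , zero) ∷ []
diagFrom m (suc n) = (m , suc n) ∷ diagFrom (suc m) n

antidiagonal : Pos → List Pos
antidiagonal (i , j) = diagFrom 0 (i + j)

∈-diagFrom : ∀ i j m → (m + i , j) ∈ diagFrom m (i + j)
∈-diagFrom zero    zero    m rewrite +-identityʳ m = here refl
∈-diagFrom zero    (suc j) m rewrite +-identityʳ m = here refl
∈-diagFrom (suc i) j       m rewrite +-suc m i = there (∈-diagFrom i j (suc m))

∈-antidiagonal : ∀ p → p ∈ antidiagonal p
∈-antidiagonal (i , j) = ∈-diagFrom i j 0

pluses : PipeDream → List Pos → List Pos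
pluses P []       = []
pluses P (x ∷ xs) = if P x then x ∷ pluses P xs else pluses P xs

∈-pluses : ∀ (P : PipeDream) {p xs} → p ∈ xs → P p ≡ true → p ∈ pluses P xs
∈-pluses P {xs = x ∷ _} (here refl) Pp rewrite Pp = here refl
∈-pluses P {xs = x ∷ _} (there p∈) Pp with P x
... | true  = there (∈-pluses P p∈ Pp)
... | false = ∈-pluses P p∈ Pp

labelWord : {I : Set} → PipeDream → (Pos → I) → List Pos → List I
labelWord P L xs = map L (pluses P xs)

map-≡⇒agree : {A B : Set} {f g : A → B} {x : A} (xs : List A) →
              map f xs ≡ map g xs → x ∈ xs → f x ≡ g x
map-≡⇒agree (_ ∷ xs) eq (here refl) = proj₁ (∷-injective eq)
map-≡⇒agree (_ ∷ xs) eq (there x∈)  = map-≡⇒agree xs (proj₂ (∷-injective eq)) x∈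

-- Adjacent a b xs: every occurrence of a in xs is immediately followed by b,
-- and b occurs only there.
data Adjacent (a b : Pos) : List Pos → Set where
  []    : Adjacent a b []
  pair  : ∀ {zs} → Adjacent a b zs → Adjacent a b (a ∷ b ∷ zs)
  other : ∀ {x xs} → x ≢ a → x ≢ b → Adjacent a b xs → Adjacent a b (x ∷ xs)

mutual
  diagFrom-adjacent-at : ∀ i k → Adjacent (i , suc k) (suc i , k) (diagFrom i (suc k))
  diagFrom-adjacent-at i zero    = pair []
  diagFrom-adjacent-at i (suc k) = pair (diagFrom-adjacent i (suc k) k (suc (suc i)) (λ ()))

  diagFrom-adjacent : ∀ i k n m → (m , n) ≢ (suc i , k) →
                      Adjacent (i , suc k) (suc i , k) (diagFrom m n)
  diagFrom-adjacent i k zero    m m≢b = other (λ ()) m≢b []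
  diagFrom-adjacent i k (suc n) m m≢b with (m , suc n) ≟ₚ (i , suc k)
  ... | yes refl = diagFrom-adjacent-at i k
  ... | no m≢a   = other m≢a m≢b (diagFrom-adjacent i k n (suc m) λ { refl → m≢a refl })

antidiagonal-adjacent : ∀ i k p → Adjacent (i , suc k) (suc i , k) (antidiagonal p)
antidiagonal-adjacent i k _ = diagFrom-adjacent i k _ 0 (λ ())

module MovePlus {I : Set} {a b : Pos} {P P' : PipeDream} {L L' : Pos → I}
  (Pa : P a ≡ false) (Pb : P b ≡ true) (P'a : P' a ≡ true) (P'b : P' b ≡ false)
  (P'-elsewhere : ∀ x → x ≢ a → x ≢ b → P' x ≡ P x)
  (L'a : L' a ≡ L b) (L'-elsewhere : ∀ x → x ≢ a → L' x ≡ L x) where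

  labelWord-invariant : ∀ {xs} → Adjacent a b xs → labelWord P' L' xs ≡ labelWord P L xs
  labelWord-invariant []         = refl
  labelWord-invariant (pair adj) rewrite Pa | Pb | P'a | P'b =
    cong₂ _∷_ L'a (labelWord-invariant adj)
  labelWord-invariant (other {x} x≢a x≢b adj) rewrite P'-elsewhere x x≢a x≢b with P x
  ... | true  = cong₂ _∷_ (L'-elsewhere x x≢a) (labelWord-invariant adj)
  ... | false = labelWord-invariant adj

≟ₚ-refl : ∀ p → ⌊ p ≟ₚ p ⌋ ≡ true
≟ₚ-refl p = trans (isYes≗does (p ≟ₚ p)) (dec-true (p ≟ₚ p) refl)

≟ₚ-≢ : ∀ {p q} → p ≢ q → ⌊ p ≟ₚ q ⌋ ≡ false
≟ₚ-≢ {p} {q} p≢q = trans (isYes≗does (p ≟ₚ q)) (dec-false (p ≟ₚ q) p≢q)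

move-preserves-labelWord : {I : Set} {P P' : PipeDream} (m : SimpleLadderMove P P')
  (L : Pos → I) (p : Pos) →
  labelWord P' (inheritStep m L) (antidiagonal p) ≡ labelWord P L (antidiagonal p)
move-preserves-labelWord {P = P} {P' = P'} m@(move i k Pa Pb _ _ P'≡) L p =
  MovePlus.labelWord-invariant Pa Pb P'a P'b P'-elsewhere L'a L'-elsewhere
    (antidiagonal-adjacent i k p)
  where
    a≢b : (i , suc k) ≢ (suc i , k)
    a≢b ()

    P'a : P' (i , suc k) ≡ true
    P'a rewrite P'≡ (i , suc k) | ≟ₚ-refl (i , suc k) = refl

    P'b : P' (suc i , k) ≡ false
    P'b rewrite P'≡ (suc i , k) | ≟ₚ-≢ (λ e → a≢b (sym e)) | ≟ₚ-refl (suc i , k) = refl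

    P'-elsewhere : ∀ x → x ≢ (i , suc k) → x ≢ (suc i , k) → P' x ≡ P x
    P'-elsewhere x x≢a x≢b rewrite P'≡ x | ≟ₚ-≢ x≢a | ≟ₚ-≢ x≢b = refl

    L'a : inheritStep m L (i , suc k) ≡ L (suc i , k)
    L'a rewrite ≟ₚ-refl (i , suc k) = refl

    L'-elsewhere : ∀ x → x ≢ (i , suc k) → inheritStep m L x ≡ L x
    L'-elsewhere x x≢a rewrite ≟ₚ-≢ x≢a = refl

path-preserves-labelWord : {I : Set} {P Q : PipeDream} (π : LadderPath P Q)
  (L : Pos → I) (p : Pos) →
  labelWord Q (inherit π L) (antidiagonal p) ≡ labelWord P L (antidiagonal p)
path-preserves-labelWord done       L p = refl
path-preserves-labelWord (step m π) L p =
  trans (path-preserves-labelWord π (inheritStep m L) p) (move-preserves-labelWord m L p)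

lemma3p3 : {I : Set} (P Q : PipeDream) (L : Pos → I) → IsLabeling P L →
           (π₁ π₂ : LadderPath P Q) →
           ∀ p → Q p ≡ true → inherit π₁ L p ≡ inherit π₂ L p
lemma3p3 P Q L _ π₁ π₂ p Qp =
  map-≡⇒agree (pluses Q (antidiagonal p)) sameWord
    (∈-pluses Q (∈-antidiagonal p) Qp)
  where
    sameWord : labelWord Q (inherit π₁ L) (antidiagonal p)
             ≡ labelWord Q (inherit π₂ L) (antidiagonal p)
    sameWord = trans (path-preserves-labelWord π₁ L p) (sym (path-preserves-labelWord π₂ L p))
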